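{- Let $r\geq 2$ be an integer and let $G$ be a bipartite graph with maximum degree $\Delta(G)=2r$ such that $d_G(v)\in\{1,2,2r-2,2r-1,2r\}$ for every vertex $v\in V(G)$. Then $G$ has a cyclic interval $2r$-coloring.
   Context: All graphs are finite and undirected; multiple edges are allowed, loops are not. A proper $t$-edge coloring of $G$ is a map $\alpha:E(G)\to\{1,\dots,t\}$ with $\alpha(e)\neq\alpha(e')$ for adjacent edges $e,e'$. For a vertex $v$, $S(v,\alpha)$ is the set of colors on edges incident to $v$. A proper $t$-edge coloring $\alpha$ is a cyclic interval $t$-coloring if for every vertex $v$, either $S(v,\alpha)$ is a set of consecutive integers, or $\{1,\dots,t\}\setminus S(v,\alpha)$ is a set of consecutive integers. -}

module Defs where

open import Data.Nat using (ℕ; _≤_; _∸_; _*_)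
open import Data.Fin using (Fin; _≟_)
open import Data.Fin.Properties using () renaming (_≟_ to _≟ᶠ_)
open import Data.Bool using (Bool)
open import Data.List using (List; length; filter)
open import Data.List using () renaming (length to len)
open import Data.Fin.Base using ()
open import Data.List.Base using ()
open import Data.Product using (Σ; _×_; _,_; proj₁; proj₂; ∃)
open import Data.Sum using (_⊎_)
open import Relation.Nullary using (¬_)
open import Relation.Nullary.Decidable using (_⊎-dec_)
open import Relation.Binary.PropositionalEquality using (_≡_; _≢_)
open import Function.Bundles using (_⇔_)
import Data.List as L

record Multigraph : Set where
  field
    n     : ℕ
    m     : ℕ
    ends  : Fin m → Fin n × Fin n
    loopless : (e : Fin m) → proj₁ (ends e) ≢ proj₂ (ends e)
open Multigraph public

Incident : (G : Multigraph) → Fin (m G) → Fin (n G) → Set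
Incident G e v = (proj₁ (ends G e) ≡ v) ⊎ (proj₂ (ends G e) ≡ v)

degree : (G : Multigraph) → Fin (n G) → ℕ
degree G v = length (filter (λ e → (proj₁ (ends G e) ≟ᶠ v) ⊎-dec (proj₂ (ends G e) ≟ᶠ v))
                            (L.allFin (m G)))

Bipartite : Multigraph → Set
Bipartite G = Σ (Fin (n G) → Bool) λ side →
  (e : Fin (m G)) → side (proj₁ (ends G e)) ≢ side (proj₂ (ends G e))

MaxDegree : Multigraph → ℕ → Set
MaxDegree G d = ((v : Fin (n G)) → degree G v ≤ d) × Σ (Fin (n G)) (λ v → degree G v ≡ d)

Adjacent : (G : Multigraph) → Fin (m G) → Fin (m G) → Set
Adjacent G e e' = e ≢ e' × Σ (Fin (n G)) (λ v → Incident G e v × Incident G e' v)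

IsEdgeColoring : (G : Multigraph) → ℕ → (Fin (m G) → ℕ) → Set
IsEdgeColoring G t α = (e : Fin (m G)) → 1 ≤ α e × α e ≤ t

Proper : (G : Multigraph) → (Fin (m G) → ℕ) → Set
Proper G α = (e e' : Fin (m G)) → Adjacent G e e' → α e ≢ α e'

InS : (G : Multigraph) → (Fin (m G) → ℕ) → Fin (n G) → ℕ → Set
InS G α v c = Σ (Fin (m G)) λ e → Incident G e v × α e ≡ c

-- a set of integers (given as a predicate) is a set of consecutive integers
-- (an interval {a,...,b}; the empty set is allowed via a > b)
Consecutive : (ℕ → Set) → Set
Consecutive P = Σ ℕ λ a → Σ ℕ λ b → (c : ℕ) → P c ⇔ (a ≤ c × c ≤ b)

ComplementIn : ℕ → (ℕ → Set) → ℕ → Set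
ComplementIn t P c = (1 ≤ c × c ≤ t) × ¬ P c

CyclicIntervalColoring : (G : Multigraph) → ℕ → (Fin (m G) → ℕ) → Set
CyclicIntervalColoring G t α =
  IsEdgeColoring G t α × Proper G α ×
  ((v : Fin (n G)) → Consecutive (InS G α v) ⊎ Consecutive (ComplementIn t (InS G α v)))

module Submission where

-- Group the colours 1, …, 2r into the r consecutive pairs {2i+1, 2i+2}.  König's edge colouring theorem
-- (proved by Kempe-chain recolouring) is used three times.  First, splitting every vertex into pairs of
-- consecutive incident edges and 2-colouring the resulting bipartite graph orients G so that every
-- vertex of degree d has out- and in-degree ⌊d/2⌋ and ⌈d/2⌉.  Second, after adding r−1 dummy loops at
-- each vertex of degree 2 and one at each vertex of degree 2r−2, the tail/head bipartite graph has
-- maximum degree r; an r-colouring gives every edge a colour pair (its class) such that at each vertex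
-- the out-edges, and the in-edges, have distinct classes, and no edge shares a class with a loop at
-- its ends.  Third, every (vertex, class) is met by at most two edges, and a 2-colouring of that
-- graph chooses the colour within the pair.  A class met twice at a vertex then gives it both colours
-- of the pair, so S(v) is one colour (d = 1), one pair (d = 2: its two edges share the class left
-- free by the r−1 loops), all but the pair of its loop (d = 2r−2), all but one colour (d = 2r−1), or
-- everything (d = 2r).

open import Data.Bool using (Bool; true; false; not)
import Data.Bool as Bool
open import Data.Bool.Properties using (¬-not; not-¬)
open import Data.Empty using (⊥; ⊥-elim)
open import Data.Fin using (Fin; toℕ; fromℕ<; combine; inject≤)
open import Data.Fin.Patterns using (0F; 1F)
open import Data.Fin.Permutation.Components using (transpose; transpose-inverse)
open import Data.Fin.Properties
  using (any?; toℕ-injective; toℕ-fromℕ<; toℕ<n; pigeonhole; injective⇒≤; combine-injective; combine-surjective;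
         toℕ-combine; toℕ-inject≤; inject≤-injective; +↔⊎; *↔×)
  renaming (_≟_ to _≟ᶠ_)
open import Data.List using (List; []; _∷_; length; lookup; tabulate; allFin; map; _++_; filter)
open import Data.List.Properties using (length-tabulate; length-map; length-++; filter-accept; filter-reject; length-filter)
open import Data.List.Membership.Propositional using (_∈_; _∉_)
open import Data.List.Membership.Propositional.Properties
  using (∈-lookup; ∈-tabulate⁺; ∈-tabulate⁻; ∈-allFin; ∈-map⁺; ∈-map⁻; ∈-++⁺ˡ; ∈-++⁺ʳ; ∈-++⁻; ∈-filter⁺; ∈-filter⁻)
open import Data.List.Membership.DecPropositional using () renaming (_∈?_ to ∈?)
import Data.List.Membership.Setoid.Properties as SetoidMembership
open import Data.List.Relation.Binary.Subset.Propositional using (_⊆_)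
open import Data.List.Relation.Unary.All as All using (All)
open import Data.List.Relation.Unary.All.Properties using (¬Any⇒All¬) renaming (map⁺ to All-map⁺)
open import Data.List.Relation.Unary.Any using (here; there)
open import Data.List.Relation.Unary.Unique.Propositional using (Unique; []; _∷_)
open import Data.List.Relation.Unary.Unique.Propositional.Properties using (tabulate⁺; allFin⁺; filter⁺; map⁺; ++⁺)
open import Data.Nat using (ℕ; zero; suc; _+_; _*_; _∸_; _≤_; _<_; ⌊_/2⌋; ⌈_/2⌉; z≤n; s≤s; NonZero; >-nonZero⁻¹)
open import Data.Nat.Properties
  using (_≟_; _<?_; ≤-refl; ≤-trans; ≤-reflexive; ≤-antisym; ≤-pred; <-irrefl; <⇒≤; ≮⇒≥; n≮0; n<1⇒n≡0; n≤1+n;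
         m≤n+m; m<1+n⇒m<n∨m≡n; m≤n⇒m<n∨m≡n; suc-injective; +-suc; +-comm; +-identityʳ; +-mono-≤; *-comm;
         n≡⌊n+n/2⌋; n≡⌈n+n/2⌉)
import Data.Product
open import Data.Product using (Σ; ∃; _×_; _,_; proj₁; proj₂)
open import Data.Product.Properties using () renaming (≡-dec to ×-≡-dec)
import Data.Sum
open import Data.Sum using (_⊎_; inj₁; inj₂; [_,_]′)
open import Data.Sum.Function.Propositional using (_⊎-↔_)
open import Data.Sum.Properties using (inj₁-injective) renaming (≡-dec to ⊎-≡-dec)
open import Data.Vec.Functional using (updateAt)
open import Data.Vec.Functional.Properties using (updateAt-updates; updateAt-minimal)
open import Function using (_∘_)
open import Function.Bundles using (_⇔_; mk⇔; Equivalence; _↔_; Inverse)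
open import Function.Properties.Inverse using (↔-sym; ↔-trans; ↔-refl)
open import Relation.Binary using (DecidableEquality)
open import Relation.Binary.PropositionalEquality
open import Relation.Nullary using (¬_; Dec; yes; no; contradiction)
open import Relation.Nullary.Decidable using (_×-dec_; _⊎-dec_; ¬?; map′; decidable-stable; dec-true; dec-false)
open import Relation.Unary using (Decidable)
open import Relation.Unary.Properties using (∁?)

open import Defs hiding (Adjacent)

module _ {X : Set} where

  lookup-injective : {xs : List X} → Unique xs → ∀ i j → lookup xs i ≡ lookup xs j → i ≡ j
  lookup-injective (_ ∷ _) Fin.zero Fin.zero _ = refl
  lookup-injective (x∉ ∷ _) Fin.zero (Fin.suc j) eq = ⊥-elim (All.lookup x∉ (∈-lookup j) eq)
  lookup-injective (x∉ ∷ _) (Fin.suc i) Fin.zero eq = ⊥-elim (All.lookup x∉ (∈-lookup i) (sym eq))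
  lookup-injective (_ ∷ u) (Fin.suc i) (Fin.suc j) eq = cong Fin.suc (lookup-injective u i j eq)

  Unique-⊆⇒length≤ : {xs ys : List X} → Unique xs → xs ⊆ ys → length xs ≤ length ys
  Unique-⊆⇒length≤ u sub = injective⇒≤ λ {i} {j} eq →
    lookup-injective u i j (SetoidMembership.index-injective (setoid X) (sub (∈-lookup i)) (sub (∈-lookup j)) eq)

  AtMost : ℕ → (X → Set) → Set
  AtMost k P = Σ (List X) λ xs → length xs ≤ k × (∀ x → P x → x ∈ xs)

  AtMost-weaken : ∀ {k} {P Q : X → Set} → (∀ x → Q x → P x) → AtMost k P → AtMost k Q
  AtMost-weaken Q⇒P (xs , len , cover) = xs , len , λ x qx → cover x (Q⇒P x qx)

  AtMost-length : ∀ {k P} {ys : List X} → AtMost k P → Unique ys → (∀ {y} → y ∈ ys → P y) → length ys ≤ k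
  AtMost-length (xs , len , cover) u all = ≤-trans (Unique-⊆⇒length≤ u (λ y∈ → cover _ (all y∈))) len

module _ {M : ℕ} where

  AtMost-one : {P : Fin M → Set} → Decidable P → (∀ {x y} → P x → P y → x ≡ y) → AtMost 1 P
  AtMost-one P? unique with any? P?
  ... | yes (x , px) = x ∷ [] , ≤-refl , λ y py → here (unique py px)
  ... | no none = [] , z≤n , λ y py → ⊥-elim (none (y , py))

AtMost-⊎ : ∀ {X : Set} {a b} {P Q R : X → Set} → AtMost a P → AtMost b Q → (∀ x → R x → P x ⊎ Q x) → AtMost (a + b) R
AtMost-⊎ (xs , xs≤ , xs-cover) (ys , ys≤ , ys-cover) split =
  xs ++ ys , subst (_≤ _) (sym (length-++ xs)) (+-mono-≤ xs≤ ys≤) ,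
  λ x rx → [ ∈-++⁺ˡ ∘ xs-cover x , ∈-++⁺ʳ xs ∘ ys-cover x ]′ (split x rx)

module _ {R : ℕ} where

  ∉⇒Unique-∷ : ∀ {i} {cs : List (Fin R)} → i ∉ cs → Unique cs → Unique (i ∷ cs)
  ∉⇒Unique-∷ i∉ u = ¬Any⇒All¬ _ i∉ ∷ u

  Unique⇒length≤ : {cs : List (Fin R)} → Unique cs → length cs ≤ R
  Unique⇒length≤ u = ≤-trans (Unique-⊆⇒length≤ u (λ {i} _ → ∈-allFin i)) (≤-reflexive (length-tabulate (λ i → i)))

  Unique-full : {cs : List (Fin R)} → Unique cs → length cs ≡ R → ∀ i → i ∈ cs
  Unique-full {cs} u len i with ∈? _≟ᶠ_ i cs
  ... | yes i∈ = i∈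
  ... | no i∉ = contradiction (subst (λ k → suc k ≤ R) len (Unique⇒length≤ (∉⇒Unique-∷ i∉ u))) (<-irrefl refl)

  Unique-misses-one : {cs : List (Fin R)} → Unique cs → suc (length cs) ≡ R →
    Σ (Fin R) λ j → j ∉ cs × (∀ i → i ≢ j → i ∈ cs)
  Unique-misses-one {cs} u len with any? (λ j → ¬? (∈? _≟ᶠ_ j cs))
  ... | no none = contradiction (≤-trans (≤-reflexive len) all-in) (<-irrefl refl)
    where
      all-in : R ≤ length cs
      all-in = subst (_≤ length cs) (length-tabulate (λ i → i))
        (Unique-⊆⇒length≤ (allFin⁺ R) λ {j} _ → decidable-stable (∈? _≟ᶠ_ j cs) (λ j∉ → none (j , j∉)))
  ... | yes (j , j∉) = j , j∉ , others
    where
      others : ∀ i → i ≢ j → i ∈ cs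
      others i i≢j with ∈? _≟ᶠ_ i cs
      ... | yes i∈ = i∈
      ... | no i∉ = contradiction (subst (λ k → suc k ≤ R) len
                      (Unique⇒length≤ (∉⇒Unique-∷ (λ { (here i≡j) → i≢j i≡j ; (there i∈) → i∉ i∈ }) (∉⇒Unique-∷ j∉ u))))
                    (<-irrefl refl)

module _ {X : Set} {R : ℕ} (f : X → Fin R) where

  InjectiveOn : List X → Set
  InjectiveOn xs = ∀ {x y} → x ∈ xs → y ∈ xs → x ≢ y → f x ≢ f y

  map-Unique-on : ∀ {xs} → Unique xs → InjectiveOn xs → Unique (map f xs)
  map-Unique-on [] _ = []
  map-Unique-on (x∉ ∷ u) inj =
    All-map⁺ (All.tabulate λ y∈ → inj (here refl) (there y∈) (All.lookup x∉ y∈)) ∷ map-Unique-on u (λ x∈ y∈ → inj (there x∈) (there y∈))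

  image-full : ∀ {xs} → Unique xs → InjectiveOn xs → length xs ≡ R → ∀ i → ∃ λ x → x ∈ xs × f x ≡ i
  image-full {xs} u inj len i with ∈-map⁻ f (Unique-full (map-Unique-on u inj) (trans (length-map f xs) len) i)
  ... | x , x∈ , i≡fx = x , x∈ , sym i≡fx

  image-misses-one : ∀ {xs} → Unique xs → InjectiveOn xs → suc (length xs) ≡ R →
    Σ (Fin R) λ j → (∀ {x} → x ∈ xs → f x ≢ j) × (∀ i → i ≢ j → ∃ λ x → x ∈ xs × f x ≡ i)
  image-misses-one {xs} u inj len with Unique-misses-one (map-Unique-on u inj) (trans (cong suc (length-map f xs)) len)
  ... | j , j∉ , others = j , (λ x∈ fx≡j → j∉ (subst (_∈ map f xs) fx≡j (∈-map⁺ f x∈))) , hit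
    where
      hit : ∀ i → i ≢ j → ∃ λ x → x ∈ xs × f x ≡ i
      hit i i≢j with ∈-map⁻ f (others i i≢j)
      ... | x , x∈ , i≡fx = x , x∈ , sym i≡fx

length≡1 : ∀ {X : Set} {xs : List X} → length xs ≡ 1 → ∃ λ x → x ∈ xs × ∀ {y} → y ∈ xs → y ≡ x
length≡1 {xs = x ∷ []} _ = x , here refl , λ { (here refl) → refl }

flip : Fin 2 → Fin 2
flip 0F = 1F
flip 1F = 0F

flip-≢ : ∀ b → flip b ≢ b
flip-≢ 0F ()
flip-≢ 1F ()

Fin2-cases : ∀ {b₁ b₂ : Fin 2} → b₁ ≢ b₂ → ∀ b → b ≡ b₁ ⊎ b ≡ b₂
Fin2-cases {0F} {0F} b₁≢b₂ _ = contradiction refl b₁≢b₂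
Fin2-cases {1F} {1F} b₁≢b₂ _ = contradiction refl b₁≢b₂
Fin2-cases {0F} {1F} _ 0F = inj₁ refl
Fin2-cases {0F} {1F} _ 1F = inj₂ refl
Fin2-cases {1F} {0F} _ 0F = inj₂ refl
Fin2-cases {1F} {0F} _ 1F = inj₁ refl

module König {A B : Set} (_≟ᴬ_ : DecidableEquality A) (_≟ᴮ_ : DecidableEquality B)
  {M : ℕ} (ℓ : Fin M → A) (ρ : Fin M → B) (C : ℕ) .{{_ : NonZero C}}
  (ℓ-bounded : ∀ a → AtMost C (λ e → ℓ e ≡ a)) (ρ-bounded : ∀ b → AtMost C (λ e → ρ e ≡ b)) where

  Adjacent : Fin M → Fin M → Set
  Adjacent e e' = ℓ e ≡ ℓ e' ⊎ ρ e ≡ ρ e'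

  Below : ℕ → Fin M → Set
  Below i e = toℕ e < i

  ProperBelow : ℕ → (Fin M → Fin C) → Set
  ProperBelow i c = ∀ {e e'} → Below i e → Below i e' → e ≢ e' → Adjacent e e' → c e ≢ c e'

  Misses : {N : Set} → (Fin M → N) → ℕ → (Fin M → Fin C) → N → Fin C → Set
  Misses ν i c a γ = ∀ {e} → Below i e → ν e ≡ a → c e ≢ γ

  used? : {N : Set} → DecidableEquality N → (ν : Fin M → N) → ∀ i (c : Fin M → Fin C) a γ →
    Dec (∃ λ e → Below i e × ν e ≡ a × c e ≡ γ)
  used? _≟_ ν i c a γ = any? λ e → (toℕ e <? i) ×-dec (ν e ≟ a) ×-dec (c e ≟ᶠ γ)

  -- If every colour were used at the ν-end of e₀, those C edges and e₀ would be C + 1 edges there.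
  free-colour : {N : Set} → DecidableEquality N → (ν : Fin M → N) → (∀ a → AtMost C (λ e → ν e ≡ a)) →
    ∀ i c e₀ → toℕ e₀ ≡ i → ∃ (Misses ν i c (ν e₀))
  free-colour _≟_ ν bounded i c e₀ e₀≡i with any? (λ γ → ¬? (used? _≟_ ν i c (ν e₀) γ))
  ... | yes (γ , unused) = γ , λ below ν≡ c≡ → unused (_ , below , ν≡ , c≡)
  ... | no all-used = contradiction (AtMost-length (bounded (ν e₀)) unique at-ν₀) too-long
    where
      used : ∀ γ → ∃ λ e → Below i e × ν e ≡ ν e₀ × c e ≡ γ
      used γ = decidable-stable (used? _≟_ ν i c (ν e₀) γ) (λ unused → all-used (γ , unused))
      witness : Fin C → Fin M
      witness γ = proj₁ (used γ)
      too-long : ¬ length (e₀ ∷ tabulate witness) ≤ C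
      too-long = <-irrefl refl ∘ subst (λ k → suc k ≤ C) (length-tabulate witness)
      unique : Unique (e₀ ∷ tabulate witness)
      unique = ¬Any⇒All¬ _ e₀∉ ∷ tabulate⁺ λ {γ} {δ} eq → trans (sym (witness-colour γ)) (trans (cong c eq) (witness-colour δ))
        where
          witness-colour : ∀ γ → c (witness γ) ≡ γ
          witness-colour γ = proj₂ (proj₂ (proj₂ (used γ)))
          e₀∉ : e₀ ∉ tabulate witness
          e₀∉ e₀∈ with ∈-tabulate⁻ e₀∈
          ... | γ , e₀≡w = <-irrefl e₀≡i (subst (Below i) (sym e₀≡w) (proj₁ (proj₂ (used γ))))
      at-ν₀ : ∀ {e} → e ∈ e₀ ∷ tabulate witness → ν e ≡ ν e₀
      at-ν₀ (here refl) = refl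
      at-ν₀ (there e∈) with ∈-tabulate⁻ e∈
      ... | γ , e≡w = trans (cong ν e≡w) (proj₁ (proj₂ (proj₂ (used γ))))

  below-suc : ∀ {i e e₀} → toℕ e₀ ≡ i → Below (suc i) e → e ≡ e₀ ⊎ Below i e
  below-suc e₀≡i e<1+i with m<1+n⇒m<n∨m≡n e<1+i
  ... | inj₁ e<i = inj₂ e<i
  ... | inj₂ e≡i = inj₁ (toℕ-injective (trans e≡i (sym e₀≡i)))

  Adjacent-sym : ∀ {e e'} → Adjacent e e' → Adjacent e' e
  Adjacent-sym (inj₁ eq) = inj₁ (sym eq)
  Adjacent-sym (inj₂ eq) = inj₂ (sym eq)

  extend : ∀ {i c e₀ γ} → toℕ e₀ ≡ i → ProperBelow i c → Misses ℓ i c (ℓ e₀) γ → Misses ρ i c (ρ e₀) γ →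
    ProperBelow (suc i) (updateAt c e₀ (λ _ → γ))
  extend {i} {c} {e₀} {γ} e₀≡i proper ℓ-free ρ-free = proper′
    where
      c′ : Fin M → Fin C
      c′ = updateAt c e₀ (λ _ → γ)
      old : ∀ {e} → Below i e → c′ e ≡ c e
      old e<i = updateAt-minimal _ e₀ c (λ { refl → <-irrefl e₀≡i e<i })
      new : ∀ {e} → Below i e → Adjacent e₀ e → c′ e₀ ≢ c′ e
      new e<i adj eq = free adj (trans (sym (old e<i)) (trans (sym eq) (updateAt-updates e₀ c)))
        where
          free : Adjacent e₀ _ → _ ≡ γ → ⊥
          free (inj₁ ℓ≡) = ℓ-free e<i (sym ℓ≡)
          free (inj₂ ρ≡) = ρ-free e<i (sym ρ≡)
      proper′ : ProperBelow (suc i) c′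
      proper′ e< e'< e≢e' adj with below-suc e₀≡i e< | below-suc e₀≡i e'<
      ... | inj₁ refl | inj₁ refl = contradiction refl e≢e'
      ... | inj₁ refl | inj₂ e'<i = new e'<i adj
      ... | inj₂ e<i | inj₁ refl = new e<i (Adjacent-sym adj) ∘ sym
      ... | inj₂ e<i | inj₂ e'<i = λ eq → proper e<i e'<i e≢e' adj (trans (sym (old e<i)) (trans eq (old e'<i)))

  module AlternatingPath {i : ℕ} {c : Fin M → Fin C} (proper : ProperBelow i c) {α β : Fin C} {e₁ : Fin M}
    (e₁<i : Below i e₁) (c₁≡α : c e₁ ≡ α) (β-free : Misses ρ i c (ρ e₁) β) where

    α≢β : α ≢ β
    α≢β α≡β = β-free e₁<i refl (trans c₁≡α α≡β)

    same-colour : ∀ {e e'} → Below i e → Below i e' → Adjacent e e' → c e ≡ c e' → e ≡ e'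
    same-colour e<i e'<i adj eq with _ ≟ᶠ _
    ... | yes e≡e' = e≡e'
    ... | no e≢e' = contradiction eq (proper e<i e'<i e≢e' adj)

    Step : Fin M → Fin M → Set
    Step e f = Below i e × Below i f × ((c e ≡ α × ℓ f ≡ ℓ e × c f ≡ β) ⊎ (c e ≡ β × ρ f ≡ ρ e × c f ≡ α))

    step? : ∀ e f → Dec (Step e f)
    step? e f = (toℕ e <? i) ×-dec (toℕ f <? i) ×-dec
      ((c e ≟ᶠ α ×-dec ℓ f ≟ᴬ ℓ e ×-dec c f ≟ᶠ β) ⊎-dec (c e ≟ᶠ β ×-dec ρ f ≟ᴮ ρ e ×-dec c f ≟ᶠ α))

    step-functional : ∀ {e f f'} → Step e f → Step e f' → f ≡ f'
    step-functional (_ , f< , inj₁ (_ , ℓf , cf)) (_ , f'< , inj₁ (_ , ℓf' , cf')) =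
      same-colour f< f'< (inj₁ (trans ℓf (sym ℓf'))) (trans cf (sym cf'))
    step-functional (_ , f< , inj₂ (_ , ρf , cf)) (_ , f'< , inj₂ (_ , ρf' , cf')) =
      same-colour f< f'< (inj₂ (trans ρf (sym ρf'))) (trans cf (sym cf'))
    step-functional (_ , _ , inj₁ (ce , _)) (_ , _ , inj₂ (ce' , _)) = contradiction (trans (sym ce) ce') α≢β
    step-functional (_ , _ , inj₂ (ce , _)) (_ , _ , inj₁ (ce' , _)) = contradiction (trans (sym ce') ce) α≢β

    step-injective : ∀ {e e' f} → Step e f → Step e' f → e ≡ e'
    step-injective (e< , _ , inj₁ (ce , ℓf , _)) (e'< , _ , inj₁ (ce' , ℓf' , _)) =
      same-colour e< e'< (inj₁ (trans (sym ℓf) ℓf')) (trans ce (sym ce'))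
    step-injective (e< , _ , inj₂ (ce , ρf , _)) (e'< , _ , inj₂ (ce' , ρf' , _)) =
      same-colour e< e'< (inj₂ (trans (sym ρf) ρf')) (trans ce (sym ce'))
    step-injective (_ , _ , inj₁ (_ , _ , cf)) (_ , _ , inj₂ (_ , _ , cf')) = contradiction (trans (sym cf') cf) α≢β
    step-injective (_ , _ , inj₂ (_ , _ , cf)) (_ , _ , inj₁ (_ , _ , cf')) = contradiction (trans (sym cf) cf') α≢β

    ¬step-e₁ : ∀ {e} → ¬ Step e e₁
    ¬step-e₁ (_ , _ , inj₁ (_ , _ , c₁≡β)) = α≢β (trans (sym c₁≡α) c₁≡β)
    ¬step-e₁ (e< , _ , inj₂ (ce≡β , ρ₁≡ , _)) = β-free e< (sym ρ₁≡) ce≡β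

    data Reach : ℕ → Fin M → Set where
      start : Reach 0 e₁
      step  : ∀ {t e f} → Reach t e → Step e f → Reach (suc t) f

    reach? : ∀ t f → Dec (Reach t f)
    reach? zero f with f ≟ᶠ e₁
    ... | yes refl = yes start
    ... | no f≢e₁ = no λ { start → f≢e₁ refl }
    reach? (suc t) f with any? (λ e → reach? t e ×-dec step? e f)
    ... | yes (_ , r , s) = yes (step r s)
    ... | no none = no λ { (step r s) → none (_ , r , s) }

    reach-injective : ∀ {s t e} → Reach s e → Reach t e → s ≡ t
    reach-injective start start = refl
    reach-injective start (step _ s) = ⊥-elim (¬step-e₁ s)
    reach-injective (step _ s) start = ⊥-elim (¬step-e₁ s)
    reach-injective (step r s) (step r' s') with step-injective s s'
    ... | refl = cong suc (reach-injective r r')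

    reach-earlier : ∀ {s t e} → s ≤ t → Reach t e → ∃ (Reach s)
    reach-earlier s≤t r with m≤n⇒m<n∨m≡n s≤t | r
    ... | inj₂ refl | _ = _ , r
    ... | inj₁ s<0 | start = ⊥-elim (n≮0 s<0)
    ... | inj₁ s<t | step r' _ = reach-earlier (≤-pred s<t) r'

    -- by pigeonhole, since the path never revisits an edge (reach-injective)
    reach-bound : ∀ {t e} → Reach t e → t < M
    reach-bound {t} r with t <? M
    ... | yes t<M = t<M
    ... | no t≮M = ⊥-elim (repeated (pigeonhole ≤-refl (proj₁ ∘ at)))
      where
        at : (s : Fin (suc M)) → ∃ (Reach (toℕ s))
        at s = reach-earlier (≤-trans (≤-pred (toℕ<n s)) (≮⇒≥ t≮M)) r
        repeated : (∃ λ s → ∃ λ s' → toℕ s < toℕ s' × proj₁ (at s) ≡ proj₁ (at s')) → ⊥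
        repeated (s , s' , s<s' , eq) =
          <-irrefl (reach-injective (proj₂ (at s)) (subst (Reach _) (sym eq) (proj₂ (at s')))) s<s'

    OnPath : Fin M → Set
    OnPath e = ∃ λ t → Reach t e

    onPath? : ∀ e → Dec (OnPath e)
    onPath? e = map′ (λ (t , r) → toℕ t , r) (λ (t , r) → fromℕ< (reach-bound r) , subst (λ s → Reach s e) (sym (toℕ-fromℕ< _)) r)
      (any? λ t → reach? (toℕ t) e)

    onPath-below : ∀ {e} → OnPath e → Below i e
    onPath-below (_ , start) = e₁<i
    onPath-below (_ , step _ (_ , f< , _)) = f<

    onPath-colour : ∀ {e} → OnPath e → c e ≡ α ⊎ c e ≡ β
    onPath-colour (_ , start) = inj₁ c₁≡α
    onPath-colour (_ , step _ (_ , _ , inj₁ (_ , _ , cf))) = inj₂ cf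
    onPath-colour (_ , step _ (_ , _ , inj₂ (_ , _ , cf))) = inj₁ cf

    onPath-forward : ∀ {e f} → OnPath e → Step e f → OnPath f
    onPath-forward (t , r) s = suc t , step r s

    onPath-backward : ∀ {e f} → OnPath e → Step f e → OnPath f
    onPath-backward (_ , start) s = ⊥-elim (¬step-e₁ s)
    onPath-backward (_ , step r s') s with step-injective s s'
    ... | refl = _ , r

    swapped : Fin M → Fin C
    swapped e with onPath? e
    ... | yes _ = transpose α β (c e)
    ... | no _ = c e

    swapped-on : ∀ {e} → OnPath e → swapped e ≡ transpose α β (c e)
    swapped-on {e} p with onPath? e
    ... | yes _ = refl
    ... | no ¬p = contradiction p ¬p

    swapped-off : ∀ {e} → ¬ OnPath e → swapped e ≡ c e
    swapped-off {e} ¬p with onPath? e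
    ... | yes p = contradiction p ¬p
    ... | no _ = refl

    transpose-α : transpose α β α ≡ β
    transpose-α rewrite dec-true (α ≟ᶠ α) refl = refl

    transpose-β : transpose α β β ≡ α
    transpose-β rewrite dec-false (β ≟ᶠ α) (α≢β ∘ sym) | dec-true (β ≟ᶠ β) refl = refl

    transpose-injective : ∀ {γ δ} → transpose α β γ ≡ transpose α β δ → γ ≡ δ
    transpose-injective {γ} {δ} eq = trans (sym (transpose-inverse β α)) (trans (cong (transpose β α) eq) (transpose-inverse β α))

    moved-α : ∀ {γ} → γ ≡ α → transpose α β γ ≡ β
    moved-α refl = transpose-α

    moved-β : ∀ {γ} → γ ≡ β → transpose α β γ ≡ α
    moved-β refl = transpose-β

    -- Otherwise e' would continue the path from e, forwards or backwards.
    boundary : ∀ {e e'} → OnPath e → ¬ OnPath e' → Below i e' → Adjacent e e' → transpose α β (c e) ≢ c e'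
    boundary p ¬p' e'< adj eq with onPath-colour p | adj
    ... | inj₁ ce | inj₁ ℓ≡ = ¬p' (onPath-forward p (onPath-below p , e'< , inj₁ (ce , sym ℓ≡ , trans (sym eq) (moved-α ce))))
    ... | inj₁ ce | inj₂ ρ≡ = ¬p' (onPath-backward p (e'< , onPath-below p , inj₂ (trans (sym eq) (moved-α ce) , ρ≡ , ce)))
    ... | inj₂ ce | inj₁ ℓ≡ = ¬p' (onPath-backward p (e'< , onPath-below p , inj₁ (trans (sym eq) (moved-β ce) , ℓ≡ , ce)))
    ... | inj₂ ce | inj₂ ρ≡ = ¬p' (onPath-forward p (onPath-below p , e'< , inj₂ (ce , sym ρ≡ , trans (sym eq) (moved-β ce))))

    swapped-proper : ProperBelow i swapped
    swapped-proper {e} {e'} e< e'< e≢e' adj eq = by-cases (onPath? e) (onPath? e')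
      where
        by-cases : Dec (OnPath e) → Dec (OnPath e') → ⊥
        by-cases (yes p) (yes p') = proper e< e'< e≢e' adj (transpose-injective (trans (sym (swapped-on p)) (trans eq (swapped-on p'))))
        by-cases (no ¬p) (no ¬p') = proper e< e'< e≢e' adj (trans (sym (swapped-off ¬p)) (trans eq (swapped-off ¬p')))
        by-cases (yes p) (no ¬p') = boundary p ¬p' e'< adj (trans (sym (swapped-on p)) (trans eq (swapped-off ¬p')))
        by-cases (no ¬p) (yes p') = boundary p' ¬p e< (Adjacent-sym adj) (trans (sym (swapped-on p')) (trans (sym eq) (swapped-off ¬p)))

    swapped-α : ∀ {e} → swapped e ≡ α → OnPath e × c e ≡ β ⊎ ¬ OnPath e × c e ≡ α
    swapped-α {e} eq = by-cases (onPath? e)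
      where
        by-cases : Dec (OnPath e) → OnPath e × c e ≡ β ⊎ ¬ OnPath e × c e ≡ α
        by-cases (no ¬p) = inj₂ (¬p , trans (sym (swapped-off ¬p)) eq)
        by-cases (yes p) with onPath-colour p
        ... | inj₁ ce = contradiction (trans (sym (moved-α ce)) (trans (sym (swapped-on p)) eq)) (α≢β ∘ sym)
        ... | inj₂ ce = inj₁ (p , ce)

    α-free-at-ρ₁ : Misses ρ i swapped (ρ e₁) α
    α-free-at-ρ₁ e< ρ≡ eq with swapped-α eq
    ... | inj₁ (_ , ce) = β-free e< ρ≡ ce
    ... | inj₂ (¬p , ce) = ¬p (subst OnPath (same-colour e₁<i e< (inj₂ (sym ρ≡)) (trans c₁≡α (sym ce))) (0 , start))

    α-free-preserved : ∀ {a} → Misses ℓ i c a α → Misses ℓ i swapped a α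
    α-free-preserved α-free e< ℓ≡ eq with swapped-α eq
    ... | inj₂ (_ , ce) = α-free e< ℓ≡ ce
    ... | inj₁ ((_ , start) , ce) = α≢β (trans (sym c₁≡α) ce)
    ... | inj₁ ((_ , step _ (y< , _ , inj₁ (cy , ℓ≡y , _))) , _) = α-free y< (trans (sym ℓ≡y) ℓ≡) cy
    ... | inj₁ ((_ , step _ (_ , _ , inj₂ (_ , _ , ce'))) , ce) = α≢β (trans (sym ce') ce)

  -- Colour the next edge e₀ with a colour α free at its ℓ-end; if α is used at its ρ-end,
  -- first swap α with a colour β free there along the α/β path starting at that ρ-end.
  colour-next : ∀ {i c} e₀ → toℕ e₀ ≡ i → ProperBelow i c → ∃ (ProperBelow (suc i))
  colour-next {i} {c} e₀ e₀≡i proper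
    with free-colour _≟ᴬ_ ℓ ℓ-bounded i c e₀ e₀≡i | free-colour _≟ᴮ_ ρ ρ-bounded i c e₀ e₀≡i
  ... | α , α-free | β , β-free with used? _≟ᴮ_ ρ i c (ρ e₀) α
  ... | no unused = _ , extend e₀≡i proper α-free (λ e< ρ≡ ce → unused (_ , e< , ρ≡ , ce))
  ... | yes (e₁ , e₁<i , ρ₁≡ρ₀ , c₁≡α) =
    _ , extend e₀≡i swapped-proper (α-free-preserved α-free) (subst (λ b → Misses ρ i swapped b α) ρ₁≡ρ₀ α-free-at-ρ₁)
    where open AlternatingPath proper e₁<i c₁≡α (subst (λ b → Misses ρ i c b β) (sym ρ₁≡ρ₀) β-free)

  colouring-below : ∀ i → i ≤ M → ∃ (ProperBelow i)
  colouring-below zero _ = (λ _ → fromℕ< (>-nonZero⁻¹ C)) , λ e<0 → ⊥-elim (n≮0 e<0)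
  colouring-below (suc i) i<M = colour-next (fromℕ< i<M) (toℕ-fromℕ< i<M) (proj₂ (colouring-below i (<⇒≤ i<M)))

  konig : Σ (Fin M → Fin C) λ c → ∀ {e e'} → e ≢ e' → Adjacent e e' → c e ≢ c e'
  konig with colouring-below M ≤-refl
  ... | c , proper = c , proper (toℕ<n _) (toℕ<n _)

module _ {X A B : Set} (_≟ᴬ_ : DecidableEquality A) (_≟ᴮ_ : DecidableEquality B) {M : ℕ} (enum : X ↔ Fin M)
  (ℓ : X → A) (ρ : X → B) (C : ℕ) .{{_ : NonZero C}}
  (ℓ-bounded : ∀ a → AtMost C (λ x → ℓ x ≡ a)) (ρ-bounded : ∀ b → AtMost C (λ x → ρ x ≡ b)) where

  open Inverse enum

  konig-↔ : Σ (X → Fin C) λ c → ∀ {x y} → x ≢ y → ℓ x ≡ ℓ y ⊎ ρ x ≡ ρ y → c x ≢ c y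
  konig-↔ with König.konig _≟ᴬ_ _≟ᴮ_ (ℓ ∘ from) (ρ ∘ from) C (enumerate ℓ ℓ-bounded) (enumerate ρ ρ-bounded)
    where
      enumerate : {N : Set} (ν : X → N) → (∀ a → AtMost C (λ x → ν x ≡ a)) → ∀ a → AtMost C (λ e → ν (from e) ≡ a)
      enumerate ν bounded a with bounded a
      ... | xs , len , cover = map to xs , subst (_≤ C) (sym (length-map to xs)) len ,
                               λ e νe≡a → subst (_∈ map to xs) (strictlyInverseˡ e) (∈-map⁺ to (cover (from e) νe≡a))
  ... | c , proper = c ∘ to , λ x≢y adj → proper (x≢y ∘ to-injective) (Data.Sum.map (back ℓ) (back ρ) adj)
    where
      to-injective : ∀ {x y} → to x ≡ to y → x ≡ y
      to-injective {x} {y} eq = trans (sym (strictlyInverseʳ x)) (trans (cong from eq) (strictlyInverseʳ y))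
      back : {N : Set} (ν : X → N) → ∀ {x y} → ν x ≡ ν y → ν (from (to x)) ≡ ν (from (to y))
      back ν {x} {y} eq = trans (cong ν (strictlyInverseʳ x)) (trans eq (sym (cong ν (strictlyInverseʳ y))))

-- Consecutive entries 2j and 2j+1 of a list form its j-th pair.
module Pairing {X : Set} (_≟_ : DecidableEquality X) where

  pairIndex : List X → X → ℕ
  pairIndex (x ∷ y ∷ xs) z with z ≟ x | z ≟ y
  ... | no _ | no _ = suc (pairIndex xs z)
  ... | _ | _ = 0
  pairIndex _ _ = 0

  pairAt : List X → ℕ → List X
  pairAt (x ∷ y ∷ xs) zero = x ∷ y ∷ []
  pairAt (x ∷ y ∷ xs) (suc j) = pairAt xs j
  pairAt xs _ = xs

  pairAt-length : ∀ xs j → length (pairAt xs j) ≤ 2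
  pairAt-length [] j = z≤n
  pairAt-length (x ∷ []) j = s≤s z≤n
  pairAt-length (x ∷ y ∷ xs) zero = ≤-refl
  pairAt-length (x ∷ y ∷ xs) (suc j) = pairAt-length xs j

  ∈-pairAt : ∀ {z} xs → z ∈ xs → z ∈ pairAt xs (pairIndex xs z)
  ∈-pairAt (x ∷ []) z∈ = z∈
  ∈-pairAt {z} (x ∷ y ∷ xs) z∈ with z ≟ x | z ≟ y | z∈
  ... | yes refl | _ | _ = here refl
  ... | no _ | yes refl | _ = there (here refl)
  ... | no z≢x | no _ | here z≡x = contradiction z≡x z≢x
  ... | no _ | no z≢y | there (here z≡y) = contradiction z≡y z≢y
  ... | no _ | no _ | there (there z∈xs) = ∈-pairAt xs z∈xs

  pair-AtMost : ∀ xs j → AtMost 2 (λ z → z ∈ xs × pairIndex xs z ≡ j)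
  pair-AtMost xs j = pairAt xs j , pairAt-length xs j , λ { z (z∈ , refl) → ∈-pairAt xs z∈ }

  pairIndex-head : ∀ x y xs → pairIndex (x ∷ y ∷ xs) x ≡ pairIndex (x ∷ y ∷ xs) y
  pairIndex-head x y xs with x ≟ x | x ≟ y | y ≟ x | y ≟ y
  ... | no x≢x | _ | _ | _ = contradiction refl x≢x
  ... | _ | _ | _ | no y≢y = contradiction refl y≢y
  ... | yes _ | _ | yes _ | yes _ = refl
  ... | yes _ | _ | no _ | yes _ = refl

  pairIndex-tail : ∀ {x y xs z} → x ∉ xs → y ∉ xs → z ∈ xs → pairIndex (x ∷ y ∷ xs) z ≡ suc (pairIndex xs z)
  pairIndex-tail {x} {y} {xs} {z} x∉ y∉ z∈ with z ≟ x | z ≟ y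
  ... | yes refl | _ = contradiction z∈ x∉
  ... | no _ | yes refl = contradiction z∈ y∉
  ... | no _ | no _ = refl

  Halves : ℕ → ℕ → ℕ → Set
  Halves a b n = a ≡ ⌊ n /2⌋ × b ≡ ⌈ n /2⌉ ⊎ a ≡ ⌈ n /2⌉ × b ≡ ⌊ n /2⌋

  Halves-even : ∀ {a b} n → Halves a b (n + n) → a ≡ n × b ≡ n
  Halves-even n (inj₁ (a≡ , b≡)) = trans a≡ (sym (n≡⌊n+n/2⌋ n)) , trans b≡ (sym (n≡⌈n+n/2⌉ n))
  Halves-even n (inj₂ (a≡ , b≡)) = trans a≡ (sym (n≡⌈n+n/2⌉ n)) , trans b≡ (sym (n≡⌊n+n/2⌋ n))

  Halves-odd : ∀ {a b} n → Halves a b (suc (n + n)) → a ≡ n × b ≡ suc n ⊎ a ≡ suc n × b ≡ n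
  Halves-odd n (inj₁ (a≡ , b≡)) = inj₁ (trans a≡ (sym (n≡⌈n+n/2⌉ n)) , trans b≡ (cong suc (sym (n≡⌊n+n/2⌋ n))))
  Halves-odd n (inj₂ (a≡ , b≡)) = inj₂ (trans a≡ (cong suc (sym (n≡⌊n+n/2⌋ n))) , trans b≡ (sym (n≡⌈n+n/2⌉ n)))

  filter-halves : {P : X → Set} (P? : Decidable P) → ∀ {xs} → Unique xs →
    (∀ {z z'} → z ∈ xs → z' ∈ xs → z ≢ z' → pairIndex xs z ≡ pairIndex xs z' → P z × ¬ P z' ⊎ ¬ P z × P z') →
    Halves (length (filter P? xs)) (length (filter (∁? P?) xs)) (length xs)
  filter-halves P? {[]} _ _ = inj₁ (refl , refl)
  filter-halves P? {x ∷ []} _ _ with P? x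
  ... | yes _ = inj₂ (refl , refl)
  ... | no _ = inj₁ (refl , refl)
  filter-halves {P} P? {x ∷ y ∷ xs} (x∉ ∷ y∉ ∷ u) separated
    with separated (here refl) (there (here refl)) (All.lookup x∉ (here refl)) (pairIndex-head x y xs)
       | filter-halves P? u (λ z∈ z'∈ z≢z' eq → separated (there (there z∈)) (there (there z'∈)) z≢z'
           (trans (pairIndex-tail x∉xs y∉xs z∈) (trans (cong suc eq) (sym (pairIndex-tail x∉xs y∉xs z'∈)))))
    where
      x∉xs : x ∉ xs
      x∉xs x∈ = All.lookup x∉ (there x∈) refl
      y∉xs : y ∉ xs
      y∉xs y∈ = All.lookup y∉ y∈ refl
  ... | inj₁ (px , ¬py) | halves
    rewrite filter-accept P? {xs = y ∷ xs} px | filter-reject P? {xs = xs} ¬py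
          | filter-reject (∁? P?) {xs = y ∷ xs} (λ ¬px → ¬px px) | filter-accept (∁? P?) {xs = xs} ¬py
    = Data.Sum.map (Data.Product.map (cong suc) (cong suc)) (Data.Product.map (cong suc) (cong suc)) halves
  ... | inj₂ (¬px , py) | halves
    rewrite filter-reject P? {xs = y ∷ xs} ¬px | filter-accept P? {xs = xs} py
          | filter-accept (∁? P?) {xs = y ∷ xs} ¬px | filter-reject (∁? P?) {xs = xs} (λ ¬py → ¬py py)
    = Data.Sum.map (Data.Product.map (cong suc) (cong suc)) (Data.Product.map (cong suc) (cong suc)) halves

-- Colours 2i+1 and 2i+2 form the i-th colour pair.
module ColourPairs (r : ℕ) where

  colour : Fin r → Fin 2 → ℕ
  colour i b = suc (toℕ (combine i b))

  colour-range : ∀ i b → 1 ≤ colour i b × colour i b ≤ 2 * r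
  colour-range i b = s≤s z≤n , subst (colour i b ≤_) (*-comm r 2) (toℕ<n (combine i b))

  colour-injective : ∀ {i b i' b'} → colour i b ≡ colour i' b' → i ≡ i' × b ≡ b'
  colour-injective eq = combine-injective _ _ _ _ (toℕ-injective (suc-injective eq))

  colour-surjective : ∀ {c} → 1 ≤ c → c ≤ 2 * r → ∃ λ i → ∃ λ b → colour i b ≡ c
  colour-surjective {suc c} _ c<2r with combine-surjective (fromℕ< (subst (c <_) (*-comm 2 r) c<2r))
  ... | i , b , eq = i , b , cong suc (trans (cong toℕ eq) (toℕ-fromℕ< _))

  colour-1F : ∀ i → colour i 1F ≡ suc (colour i 0F)
  colour-1F i = cong suc (begin
    toℕ (combine i 1F)  ≡⟨ toℕ-combine i 1F ⟩
    2 * toℕ i + 1       ≡⟨ +-comm (2 * toℕ i) 1 ⟩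
    suc (2 * toℕ i)     ≡⟨ cong suc (sym (+-identityʳ (2 * toℕ i))) ⟩
    suc (2 * toℕ i + 0) ≡⟨ cong suc (sym (toℕ-combine i 0F)) ⟩
    suc (toℕ (combine i 0F)) ∎)
    where open ≡-Reasoning

  pair-consecutive : ∀ {P : ℕ → Set} i → (∀ c → P c ⇔ (∃ λ b → colour i b ≡ c)) → Consecutive P
  pair-consecutive {P} i P⇔ = colour i 0F , colour i 1F , λ c → mk⇔ (to c ∘ Equivalence.to (P⇔ c)) (Equivalence.from (P⇔ c) ∘ from c)
    where
      0F≤1F : colour i 0F ≤ colour i 1F
      0F≤1F = subst (colour i 0F ≤_) (sym (colour-1F i)) (n≤1+n _)
      to : ∀ c → (∃ λ b → colour i b ≡ c) → colour i 0F ≤ c × c ≤ colour i 1F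
      to c (0F , refl) = ≤-refl , 0F≤1F
      to c (1F , refl) = 0F≤1F , ≤-refl
      from : ∀ c → colour i 0F ≤ c × c ≤ colour i 1F → ∃ λ b → colour i b ≡ c
      from c (lo , hi) with m≤n⇒m<n∨m≡n (subst (c ≤_) (colour-1F i) hi)
      ... | inj₁ c<1+c₀ = 0F , ≤-antisym lo (≤-pred c<1+c₀)
      ... | inj₂ c≡1+c₀ = 1F , trans (colour-1F i) (sym c≡1+c₀)

  CyclicInterval : (ℕ → Set) → Set
  CyclicInterval S = Consecutive S ⊎ Consecutive (ComplementIn (2 * r) S)

  module _ {S : ℕ → Set} where

    single-colour : ∀ c₀ → (∀ c → S c ⇔ c ≡ c₀) → CyclicInterval S
    single-colour c₀ S⇔ = inj₁ (c₀ , c₀ , λ c → mk⇔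
      (λ sc → ≤-reflexive (sym (Equivalence.to (S⇔ c) sc)) , ≤-reflexive (Equivalence.to (S⇔ c) sc))
      (λ (lo , hi) → Equivalence.from (S⇔ c) (≤-antisym hi lo)))

    one-pair : ∀ i → (∀ b → S (colour i b)) → (∀ {c} → S c → ∃ λ b → colour i b ≡ c) → CyclicInterval S
    one-pair i present only = inj₁ (pair-consecutive i λ c → mk⇔ only λ { (b , refl) → present b })

    all-colours : (∀ i b → S (colour i b)) → (∀ {c} → S c → 1 ≤ c × c ≤ 2 * r) → CyclicInterval S
    all-colours present range = inj₁ (1 , 2 * r , λ c → mk⇔ range λ (lo , hi) → present′ (colour-surjective lo hi))
      where
        present′ : ∀ {c} → (∃ λ i → ∃ λ b → colour i b ≡ c) → S c
        present′ (i , b , refl) = present i b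

    all-but-pair : ∀ i → (∀ j → j ≢ i → ∀ b → S (colour j b)) → (∀ b → ¬ S (colour i b)) → CyclicInterval S
    all-but-pair i present absent = inj₂ (pair-consecutive i λ c → mk⇔ to from)
      where
        to : ∀ {c} → ComplementIn (2 * r) S c → ∃ λ b → colour i b ≡ c
        to ((lo , hi) , ¬sc) with colour-surjective lo hi
        ... | j , b , refl with j ≟ᶠ i
        ...   | yes refl = b , refl
        ...   | no j≢i = contradiction (present j j≢i b) ¬sc
        from : ∀ {c} → (∃ λ b → colour i b ≡ c) → ComplementIn (2 * r) S c
        from (b , refl) = colour-range i b , absent b

    all-but-one : ∀ i b₀ → (∀ j b → colour j b ≢ colour i b₀ → S (colour j b)) → ¬ S (colour i b₀) → CyclicInterval S
    all-but-one i b₀ present absent = inj₂ (colour i b₀ , colour i b₀ , λ c → mk⇔ to from)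
      where
        to : ∀ {c} → ComplementIn (2 * r) S c → colour i b₀ ≤ c × c ≤ colour i b₀
        to ((lo , hi) , ¬sc) with colour-surjective lo hi
        ... | j , b , refl with colour j b ≟ colour i b₀
        ...   | yes eq = ≤-reflexive (sym eq) , ≤-reflexive eq
        ...   | no ne = contradiction (present j b ne) ¬sc
        from : ∀ {c} → colour i b₀ ≤ c × c ≤ colour i b₀ → ComplementIn (2 * r) S c
        from (lo , hi) with ≤-antisym hi lo
        ... | refl = colour-range i b₀ , absent

module BipartiteMultigraph (G : Multigraph) (side : Fin (n G) → Bool)
  (bipartite : ∀ e → side (proj₁ (ends G e)) ≢ side (proj₂ (ends G e))) where

  V E : Set
  V = Fin (n G)
  E = Fin (m G)

  end : Bool → E → V
  end b e with side (proj₁ (ends G e)) Bool.≟ b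
  ... | yes _ = proj₁ (ends G e)
  ... | no _ = proj₂ (ends G e)

  side-end : ∀ b e → side (end b e) ≡ b
  side-end b e with side (proj₁ (ends G e)) Bool.≟ b
  ... | yes eq = eq
  ... | no ne = trans (¬-not (bipartite e ∘ sym)) (sym (¬-not (ne ∘ sym)))

  end-incident : ∀ b e → Incident G e (end b e)
  end-incident b e with side (proj₁ (ends G e)) Bool.≟ b
  ... | yes _ = inj₁ refl
  ... | no _ = inj₂ refl

  incident⇒end : ∀ {e v} → Incident G e v → end (side v) e ≡ v
  incident⇒end {e} (inj₁ refl) with side (proj₁ (ends G e)) Bool.≟ side (proj₁ (ends G e))
  ... | yes _ = refl
  ... | no ne = contradiction refl ne
  incident⇒end {e} (inj₂ refl) with side (proj₁ (ends G e)) Bool.≟ side (proj₂ (ends G e))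
  ... | yes eq = contradiction eq (bipartite e)
  ... | no _ = refl

  end-≢ : ∀ b e → end b e ≢ end (not b) e
  end-≢ b e eq = not-¬ refl (trans (sym (side-end b e)) (trans (cong side eq) (side-end (not b) e)))

  module _ {L : Set} (_≟ᴸ_ : DecidableEquality L) (label : V → E → L) where

    node : Bool → E → V × L
    node b e = end b e , label (end b e) e

    same-node : ∀ {e e' v} → Incident G e v → Incident G e' v → label v e ≡ label v e' → node (side v) e ≡ node (side v) e'
    same-node {e} {e'} inc inc' eq = cong₂ _,_ (trans (incident⇒end inc) (sym (incident⇒end inc')))
      (trans (cong (λ w → label w e) (incident⇒end inc)) (trans eq (cong (λ w → label w e') (sym (incident⇒end inc')))))

    -- König's theorem for the graph in which every vertex v is split into one copy per label at v
    separate-labels : (∀ v l → AtMost 2 (λ e → Incident G e v × label v e ≡ l)) →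
      Σ (E → Fin 2) λ bit → ∀ {e e' v} → e ≢ e' → Incident G e v → Incident G e' v → label v e ≡ label v e' → bit e ≢ bit e'
    separate-labels bounded with König.konig ≟-node ≟-node (node false) (node true) 2 (bound false) (bound true)
      where
        ≟-node : DecidableEquality (V × L)
        ≟-node = ×-≡-dec _≟ᶠ_ _≟ᴸ_
        bound : ∀ b a → AtMost 2 (λ e → node b e ≡ a)
        bound b (v , l) = AtMost-weaken (λ { e refl → end-incident b e , refl }) (bounded v l)
    ... | bit , proper = bit , λ {e} {e'} {v} e≢e' inc inc' eq → proper e≢e' (either-side (side v) (same-node inc inc' eq))
      where
        either-side : ∀ b {e e'} → node b e ≡ node b e' → node false e ≡ node false e' ⊎ node true e ≡ node true e'
        either-side false = inj₁
        either-side true = inj₂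

  incident? : ∀ v → Decidable (λ e → Incident G e v)
  incident? v e = (proj₁ (ends G e) ≟ᶠ v) ⊎-dec (proj₂ (ends G e) ≟ᶠ v)

  -- degree G v is, by definition, length (edgesAt v)
  edgesAt : V → List E
  edgesAt v = filter (incident? v) (allFin (m G))

  edgesAt-unique : ∀ v → Unique (edgesAt v)
  edgesAt-unique v = filter⁺ (incident? v) {allFin (m G)} (allFin⁺ (m G))

  ∈-edgesAt : ∀ {e v} → Incident G e v → e ∈ edgesAt v
  ∈-edgesAt {e} {v} inc = ∈-filter⁺ (incident? v) (∈-allFin e) inc

  edgesAt-incident : ∀ {e v} → e ∈ edgesAt v → Incident G e v
  edgesAt-incident {v = v} e∈ = proj₂ (∈-filter⁻ (incident? v) {xs = allFin (m G)} e∈)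

  open Pairing (_≟ᶠ_ {m G}) using (pairIndex; pair-AtMost; Halves; filter-halves)

  -- abstract, since unfolding colourings found by search makes type checking very costly
  abstract
    pairing : Σ (E → Fin 2) λ bit → ∀ {e e' v} → e ≢ e' → Incident G e v → Incident G e' v →
      pairIndex (edgesAt v) e ≡ pairIndex (edgesAt v) e' → bit e ≢ bit e'
    pairing = separate-labels _≟_ (λ v → pairIndex (edgesAt v))
      (λ v l → AtMost-weaken (λ e (inc , eq) → ∈-edgesAt inc , eq) (pair-AtMost (edgesAt v) l))

  isOne : Fin 2 → Bool
  isOne 0F = false
  isOne 1F = true

  isOne-injective : ∀ {b b'} → isOne b ≡ isOne b' → b ≡ b'
  isOne-injective {0F} {0F} _ = refl
  isOne-injective {1F} {1F} _ = refl
  isOne-injective {0F} {1F} ()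
  isOne-injective {1F} {0F} ()

  tail head : E → V
  tail e = end (isOne (proj₁ pairing e)) e
  head e = end (not (isOne (proj₁ pairing e))) e

  tail-incident : ∀ e → Incident G e (tail e)
  tail-incident e = end-incident _ e

  head-incident : ∀ e → Incident G e (head e)
  head-incident e = end-incident _ e

  tail≢head : ∀ e → tail e ≢ head e
  tail≢head e = end-≢ _ e

  tail≡⇔ : ∀ {e v} → Incident G e v → tail e ≡ v ⇔ isOne (proj₁ pairing e) ≡ side v
  tail≡⇔ {e} inc = mk⇔ (λ eq → trans (sym (side-end _ e)) (cong side eq)) (λ eq → subst (λ b → end b e ≡ _) (sym eq) (incident⇒end inc))

  incident⇒tail⊎head : ∀ {e v} → Incident G e v → tail e ≡ v ⊎ head e ≡ v
  incident⇒tail⊎head {e} {v} inc with isOne (proj₁ pairing e) Bool.≟ side v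
  ... | yes eq = inj₁ (Equivalence.from (tail≡⇔ inc) eq)
  ... | no ne = inj₂ (subst (λ b → end b e ≡ v) (¬-not (ne ∘ sym)) (incident⇒end inc))

  outgoing incoming : V → List E
  outgoing v = filter (λ e → tail e ≟ᶠ v) (edgesAt v)
  incoming v = filter (∁? (λ e → tail e ≟ᶠ v)) (edgesAt v)

  ∈-outgoing : ∀ {e v} → tail e ≡ v → e ∈ outgoing v
  ∈-outgoing {e} {v} eq = ∈-filter⁺ (λ e → tail e ≟ᶠ v) (∈-edgesAt (subst (Incident G e) eq (tail-incident e))) eq

  outgoing-tail : ∀ {e v} → e ∈ outgoing v → tail e ≡ v
  outgoing-tail {v = v} e∈ = proj₂ (∈-filter⁻ (λ e → tail e ≟ᶠ v) {xs = edgesAt v} e∈)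

  ∈-incoming : ∀ {e v} → head e ≡ v → e ∈ incoming v
  ∈-incoming {e} {v} eq = ∈-filter⁺ (∁? (λ e → tail e ≟ᶠ v)) (∈-edgesAt (subst (Incident G e) eq (head-incident e)))
    (λ tail≡ → tail≢head e (trans tail≡ (sym eq)))

  incoming-head : ∀ {e v} → e ∈ incoming v → head e ≡ v
  incoming-head {e} {v} e∈ with ∈-filter⁻ (∁? (λ e → tail e ≟ᶠ v)) {xs = edgesAt v} e∈
  ... | e∈′ , tail≢v with incident⇒tail⊎head (edgesAt-incident e∈′)
  ...   | inj₁ tail≡v = contradiction tail≡v tail≢v
  ...   | inj₂ head≡v = head≡v

  outgoing-unique : ∀ v → Unique (outgoing v)
  outgoing-unique v = filter⁺ (λ e → tail e ≟ᶠ v) {edgesAt v} (edgesAt-unique v)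

  incoming-unique : ∀ v → Unique (incoming v)
  incoming-unique v = filter⁺ (∁? (λ e → tail e ≟ᶠ v)) {edgesAt v} (edgesAt-unique v)

  degree-halves : ∀ v → Halves (length (outgoing v)) (length (incoming v)) (degree G v)
  degree-halves v = filter-halves (λ e → tail e ≟ᶠ v) (edgesAt-unique v) separated
    where
      separated : ∀ {z z'} → z ∈ edgesAt v → z' ∈ edgesAt v → z ≢ z' → pairIndex (edgesAt v) z ≡ pairIndex (edgesAt v) z' →
        tail z ≡ v × tail z' ≢ v ⊎ tail z ≢ v × tail z' ≡ v
      separated {z} {z'} z∈ z'∈ z≢z' eq = by-cases (isOne (proj₁ pairing z) Bool.≟ side v)
        where
          inc : Incident G z v
          inc = edgesAt-incident z∈
          inc' : Incident G z' v
          inc' = edgesAt-incident z'∈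
          bits≢ : isOne (proj₁ pairing z) ≢ isOne (proj₁ pairing z')
          bits≢ = proj₂ pairing z≢z' inc inc' eq ∘ isOne-injective
          by-cases : Dec (isOne (proj₁ pairing z) ≡ side v) → tail z ≡ v × tail z' ≢ v ⊎ tail z ≢ v × tail z' ≡ v
          by-cases (yes bz≡) = inj₁ (Equivalence.from (tail≡⇔ inc) bz≡ , λ tail'≡ → bits≢ (trans bz≡ (sym (Equivalence.to (tail≡⇔ inc') tail'≡))))
          by-cases (no bz≢) = inj₂ (bz≢ ∘ Equivalence.to (tail≡⇔ inc) ,
                               Equivalence.from (tail≡⇔ inc') (trans (¬-not (bits≢ ∘ sym)) (sym (¬-not (bz≢ ∘ sym)))))

  data Direction : Set where
    outward inward : Direction

  opposite : Direction → Direction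
  opposite outward = inward
  opposite inward = outward

  endpoint : Direction → E → V
  endpoint outward = tail
  endpoint inward = head

  edges : Direction → V → List E
  edges outward = outgoing
  edges inward = incoming

  ∈-edges : ∀ d {e v} → endpoint d e ≡ v → e ∈ edges d v
  ∈-edges outward = ∈-outgoing
  ∈-edges inward = ∈-incoming

  edges-endpoint : ∀ d {e v} → e ∈ edges d v → endpoint d e ≡ v
  edges-endpoint outward = outgoing-tail
  edges-endpoint inward = incoming-head

  edges-unique : ∀ d v → Unique (edges d v)
  edges-unique outward = outgoing-unique
  edges-unique inward = incoming-unique

  edges-length : ∀ d v → length (edges d v) ≤ degree G v
  edges-length outward v = length-filter (λ e → tail e ≟ᶠ v) (edgesAt v)
  edges-length inward v = length-filter (∁? (λ e → tail e ≟ᶠ v)) (edgesAt v)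

  endpoint-incident : ∀ d e → Incident G e (endpoint d e)
  endpoint-incident outward = tail-incident
  endpoint-incident inward = head-incident

  endpoint-opposite : ∀ d e → endpoint d e ≢ endpoint (opposite d) e
  endpoint-opposite outward e = tail≢head e
  endpoint-opposite inward e = tail≢head e ∘ sym

  direction-cases : ∀ d d' → d' ≡ d ⊎ d' ≡ opposite d
  direction-cases outward outward = inj₁ refl
  direction-cases outward inward = inj₂ refl
  direction-cases inward outward = inj₂ refl
  direction-cases inward inward = inj₁ refl

  incident⇒endpoint : ∀ {e v} → Incident G e v → ∃ λ d → endpoint d e ≡ v
  incident⇒endpoint inc = [ (outward ,_) , (inward ,_) ]′ (incident⇒tail⊎head inc)

module Construction (k : ℕ) (G : Multigraph) (side : Fin (n G) → Bool)
  (bipartite : ∀ e → side (proj₁ (ends G e)) ≢ side (proj₂ (ends G e)))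
  (admissible : ∀ v → degree G v ≡ 1 ⊎ degree G v ≡ 2 ⊎ degree G v ≡ 2 * suc (suc k) ∸ 2
                        ⊎ degree G v ≡ 2 * suc (suc k) ∸ 1 ⊎ degree G v ≡ 2 * suc (suc k)) where

  open BipartiteMultigraph G side bipartite
  open Pairing (_≟ᶠ_ {m G}) using (Halves; Halves-even; Halves-odd)

  r : ℕ
  r = suc (suc k)

  data Profile (v : V) : Set where
    degree-1    : degree G v ≡ 1 → Profile v
    degree-2    : (∀ d → length (edges d v) ≡ 1) → Profile v
    degree-2r-2 : (∀ d → length (edges d v) ≡ suc k) → Profile v
    degree-2r-1 : ∀ d → length (edges d v) ≡ r → length (edges (opposite d) v) ≡ suc k → Profile v
    degree-2r   : (∀ d → length (edges d v) ≡ r) → Profile v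

  2r≡ : 2 * r ≡ suc (suc (suc k + suc k))
  2r≡ = cong (suc ∘ suc) (trans (+-suc k (suc (k + 0))) (cong (λ x → suc (k + suc x)) (+-identityʳ k)))

  even-degree : ∀ {v} h → degree G v ≡ h + h → ∀ d → length (edges d v) ≡ h
  even-degree {v} h d≡ outward = proj₁ (Halves-even h (subst (Halves _ _) d≡ (degree-halves v)))
  even-degree {v} h d≡ inward = proj₂ (Halves-even h (subst (Halves _ _) d≡ (degree-halves v)))

  abstract
    profile : ∀ v → Profile v
    profile v with admissible v
    ... | inj₁ d≡1 = degree-1 d≡1
    ... | inj₂ (inj₁ d≡2) = degree-2 (even-degree 1 d≡2)
    ... | inj₂ (inj₂ (inj₁ d≡)) = degree-2r-2 (even-degree (suc k) (trans d≡ (cong (_∸ 2) 2r≡)))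
    ... | inj₂ (inj₂ (inj₂ (inj₂ d≡))) = degree-2r (even-degree r (trans d≡ (cong (r +_) (+-identityʳ r))))
    ... | inj₂ (inj₂ (inj₂ (inj₁ d≡))) with Halves-odd (suc k) (subst (Halves _ _) (trans d≡ (cong (_∸ 1) 2r≡)) (degree-halves v))
    ...   | inj₁ (out≡ , in≡) = degree-2r-1 inward in≡ out≡
    ...   | inj₂ (out≡ , in≡) = degree-2r-1 outward out≡ in≡

  -- dummy loops raising both the out- and the in-degree of a vertex of degree 2 or 2r-2 to r
  loops : ∀ {v} → Profile v → ℕ
  loops (degree-2 _) = suc k
  loops (degree-2r-2 _) = 1
  loops _ = 0

  padded-bound : ∀ d v → length (edges d v) + loops (profile v) ≤ r
  padded-bound d v with profile v
  ... | degree-1 d≡1 = subst (_≤ r) (sym (+-identityʳ _)) (≤-trans (subst (length (edges d v) ≤_) d≡1 (edges-length d v)) (s≤s z≤n))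
  ... | degree-2 len = ≤-reflexive (cong (_+ suc k) (len d))
  ... | degree-2r-2 len = ≤-reflexive (trans (cong (_+ 1) (len d)) (+-comm (suc k) 1))
  ... | degree-2r len = ≤-reflexive (trans (+-identityʳ _) (len d))
  ... | degree-2r-1 d′ len len′ with d | d′
  ...   | outward | outward = ≤-reflexive (trans (+-identityʳ _) len)
  ...   | inward | inward = ≤-reflexive (trans (+-identityʳ _) len)
  ...   | outward | inward = ≤-trans (≤-reflexive (trans (+-identityʳ _) len′)) (n≤1+n _)
  ...   | inward | outward = ≤-trans (≤-reflexive (trans (+-identityʳ _) len′)) (n≤1+n _)

  Arc Node : Set
  Arc = E ⊎ (V × Fin r)
  Node = V ⊎ (V × Fin r)

  IsLoop : V → Fin r → Set
  IsLoop v j = toℕ j < loops (profile v)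

  -- The slot (v , j) is a loop at v if j is small enough, and otherwise an edge at a node of its own.
  slotNode : V → Fin r → Node
  slotNode v j with toℕ j <? loops (profile v)
  ... | yes _ = inj₁ v
  ... | no _ = inj₂ (v , j)

  slotNode-loop : ∀ {v j} → IsLoop v j → slotNode v j ≡ inj₁ v
  slotNode-loop {v} {j} loop with toℕ j <? loops (profile v)
  ... | yes _ = refl
  ... | no ¬loop = contradiction loop ¬loop

  slotNode-inj₁ : ∀ {v j w} → slotNode v j ≡ inj₁ w → v ≡ w × IsLoop v j
  slotNode-inj₁ {v} {j} eq with toℕ j <? loops (profile v) | eq
  ... | yes loop | refl = refl , loop

  slotNode-inj₂ : ∀ {v j a} → slotNode v j ≡ inj₂ a → a ≡ (v , j)
  slotNode-inj₂ {v} {j} eq with toℕ j <? loops (profile v) | eq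
  ... | no _ | refl = refl

  arcEnd : Direction → Arc → Node
  arcEnd d (inj₁ e) = inj₁ (endpoint d e)
  arcEnd d (inj₂ (v , j)) = slotNode v j

  loops≤r : ∀ v → loops (profile v) ≤ r
  loops≤r v = ≤-trans (m≤n+m _ _) (padded-bound outward v)

  loopsAt : V → List (Fin r)
  loopsAt v = tabulate λ t → inject≤ t (loops≤r v)

  ∈-loopsAt : ∀ {v j} → IsLoop v j → j ∈ loopsAt v
  ∈-loopsAt loop = subst (_∈ _) (toℕ-injective (trans (toℕ-inject≤ _ _) (toℕ-fromℕ< loop))) (∈-tabulate⁺ (fromℕ< loop))

  loopsAt-IsLoop : ∀ {v j} → j ∈ loopsAt v → IsLoop v j
  loopsAt-IsLoop {v} j∈ with ∈-tabulate⁻ j∈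
  ... | t , j≡t = subst (λ j → toℕ j < loops (profile v)) (sym j≡t) (subst (_< _) (sym (toℕ-inject≤ t (loops≤r v))) (toℕ<n t))

  arcsAt : Direction → V → List Arc
  arcsAt d v = map inj₁ (edges d v) ++ map (λ j → inj₂ (v , j)) (loopsAt v)

  arcsAt-length : ∀ d v → length (arcsAt d v) ≡ length (edges d v) + loops (profile v)
  arcsAt-length d v = trans (length-++ (map inj₁ (edges d v)))
    (cong₂ _+_ (length-map inj₁ (edges d v)) (trans (length-map _ (loopsAt v)) (length-tabulate _)))

  ∈-arcsAt : ∀ d {x v} → arcEnd d x ≡ inj₁ v → x ∈ arcsAt d v
  ∈-arcsAt d {inj₁ e} refl = ∈-++⁺ˡ (∈-map⁺ inj₁ (∈-edges d refl))
  ∈-arcsAt d {inj₂ (w , j)} eq with slotNode-inj₁ eq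
  ... | refl , loop = ∈-++⁺ʳ (map inj₁ (edges d w)) (∈-map⁺ _ (∈-loopsAt loop))

  arcsAt-end : ∀ d {x v} → x ∈ arcsAt d v → arcEnd d x ≡ inj₁ v
  arcsAt-end d {v = v} x∈ with ∈-++⁻ (map inj₁ (edges d v)) x∈
  ... | inj₁ x∈′ with ∈-map⁻ inj₁ x∈′
  ...   | e , e∈ , refl = cong inj₁ (edges-endpoint d e∈)
  arcsAt-end d {v = v} x∈ | inj₂ x∈′ with ∈-map⁻ _ x∈′
  ...   | j , j∈ , refl = slotNode-loop (loopsAt-IsLoop j∈)

  arcsAt-unique : ∀ d v → Unique (arcsAt d v)
  arcsAt-unique d v = ++⁺ (map⁺ inj₁-injective (edges-unique d v))
    (map⁺ (λ { refl → refl }) (tabulate⁺ (inject≤-injective _ _ _ _)))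
    (λ (x∈ , x∈′) → disjoint (∈-map⁻ inj₁ x∈) (∈-map⁻ _ x∈′))
    where
      disjoint : ∀ {x} → (∃ λ e → e ∈ edges d v × x ≡ inj₁ e) → (∃ λ j → j ∈ loopsAt v × x ≡ inj₂ (v , j)) → ⊥
      disjoint (_ , _ , refl) (_ , _ , ())

  arcEnd-bounded : ∀ d a → AtMost r (λ x → arcEnd d x ≡ a)
  arcEnd-bounded d (inj₁ v) = arcsAt d v , ≤-trans (≤-reflexive (arcsAt-length d v)) (padded-bound d v) , λ _ → ∈-arcsAt d
  arcEnd-bounded d (inj₂ (v , j)) = inj₂ (v , j) ∷ [] , s≤s z≤n , λ { (inj₂ _) eq → here (cong inj₂ (sym (slotNode-inj₂ eq))) }

  arcs↔ : Arc ↔ Fin (m G + n G * r)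
  arcs↔ = ↔-sym (↔-trans +↔⊎ (↔-refl ⊎-↔ *↔×))

  _≟ᴺ_ : DecidableEquality Node
  _≟ᴺ_ = ⊎-≡-dec _≟ᶠ_ (×-≡-dec _≟ᶠ_ _≟ᶠ_)

  abstract
    classing : Σ (Arc → Fin r) λ κ → ∀ {x y} → x ≢ y → arcEnd outward x ≡ arcEnd outward y ⊎ arcEnd inward x ≡ arcEnd inward y → κ x ≢ κ y
    classing = konig-↔ _≟ᴺ_ _≟ᴺ_ arcs↔ (arcEnd outward) (arcEnd inward) r (arcEnd-bounded outward) (arcEnd-bounded inward)

  arcClass : Arc → Fin r
  arcClass = proj₁ classing

  class : E → Fin r
  class e = arcClass (inj₁ e)

  arcClass-proper : ∀ d {x y} → x ≢ y → arcEnd d x ≡ arcEnd d y → arcClass x ≢ arcClass y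
  arcClass-proper outward x≢y eq = proj₂ classing x≢y (inj₁ eq)
  arcClass-proper inward x≢y eq = proj₂ classing x≢y (inj₂ eq)

  class-proper : ∀ d {e e'} → e ≢ e' → endpoint d e ≡ endpoint d e' → class e ≢ class e'
  class-proper d e≢e' eq = arcClass-proper d (e≢e' ∘ inj₁-injective) (cong inj₁ eq)

  class≢loop : ∀ {v j e} → IsLoop v j → Incident G e v → class e ≢ arcClass (inj₂ (v , j))
  class≢loop {v} {j} {e} loop inc with incident⇒endpoint inc
  ... | d , eq = arcClass-proper d {inj₁ e} {inj₂ (v , j)} (λ ()) (trans (cong inj₁ eq) (sym (slotNode-loop loop)))

  abstract
    class-at : ∀ d {v} → length (edges d v) + loops (profile v) ≡ r → ∀ i →
      (∀ j → IsLoop v j → arcClass (inj₂ (v , j)) ≢ i) → ∃ λ e → endpoint d e ≡ v × class e ≡ i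
    class-at d {v} len i not-loop
      with image-full arcClass (arcsAt-unique d v) classes-distinct (trans (arcsAt-length d v) len) i
      where
        classes-distinct : InjectiveOn arcClass (arcsAt d v)
        classes-distinct x∈ y∈ x≢y = arcClass-proper d x≢y (trans (arcsAt-end d x∈) (sym (arcsAt-end d y∈)))
    ... | inj₁ e , x∈ , eq = e , inj₁-injective (arcsAt-end d x∈) , eq
    ... | inj₂ (w , j) , x∈ , eq with slotNode-inj₁ (arcsAt-end d x∈)
    ...   | refl , loop = contradiction eq (not-loop j loop)

  edges-classes : ∀ d v → InjectiveOn class (edges d v)
  edges-classes d v e∈ e'∈ e≢e' = class-proper d e≢e' (trans (edges-endpoint d e∈) (sym (edges-endpoint d e'∈)))

  class-unique : ∀ d {v i} → AtMost 1 (λ e → endpoint d e ≡ v × class e ≡ i)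
  class-unique d {v} {i} = AtMost-one (λ e → (endpoint d e ≟ᶠ v) ×-dec (class e ≟ᶠ i))
    λ {e} {e'} (e≡ , ce) (e'≡ , ce') → decidable-stable (e ≟ᶠ e')
      (λ e≢e' → class-proper d e≢e' (trans e≡ (sym e'≡)) (trans ce (sym ce')))

  abstract
    bits : Σ (E → Fin 2) λ bit → ∀ {e e' v} → e ≢ e' → Incident G e v → Incident G e' v → class e ≡ class e' → bit e ≢ bit e'
    bits = separate-labels _≟ᶠ_ (λ _ → class) λ v i → AtMost-⊎ (class-unique outward) (class-unique inward) split
      where
        split : ∀ {v i} e → Incident G e v × class e ≡ i → (tail e ≡ v × class e ≡ i) ⊎ (head e ≡ v × class e ≡ i)
        split e (inc , ce) with incident⇒endpoint inc
        ... | outward , eq = inj₁ (eq , ce)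
        ... | inward , eq = inj₂ (eq , ce)

  bit : E → Fin 2
  bit = proj₁ bits

  open ColourPairs r

  colouring : E → ℕ
  colouring e = colour (class e) (bit e)

  colouring-range : IsEdgeColoring G (2 * r) colouring
  colouring-range e = colour-range (class e) (bit e)

  colouring-proper : Proper G colouring
  colouring-proper e e' (e≢e' , v , inc , inc') eq with colour-injective eq
  ... | ce , be = proj₂ bits e≢e' inc inc' ce be

  S : V → ℕ → Set
  S v = InS G colouring v

  both-colours : ∀ d {e e' v} → endpoint d e ≡ v → endpoint (opposite d) e' ≡ v → class e ≡ class e' → ∀ b → S v (colour (class e) b)
  both-colours d {e} {e'} e≡ e'≡ ce b =
    [ (λ b≡ → e , inc , cong (colour (class e)) (sym b≡)) , (λ b≡ → e' , inc' , cong₂ colour (sym ce) (sym b≡)) ]′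
    (Fin2-cases (proj₂ bits e≢e' inc inc' ce) b)
    where
      inc : Incident G e _
      inc = subst (Incident G e) e≡ (endpoint-incident d e)
      inc' : Incident G e' _
      inc' = subst (Incident G e') e'≡ (endpoint-incident (opposite d) e')
      e≢e' : e ≢ e'
      e≢e' refl = endpoint-opposite d e (trans e≡ (sym e'≡))

  doubled : ∀ {v} → (∀ d → length (edges d v) + loops (profile v) ≡ r) → ∀ i →
    (∀ j → IsLoop v j → arcClass (inj₂ (v , j)) ≢ i) → ∀ b → S v (colour i b)
  doubled full i not-loop b with class-at outward (full outward) i not-loop | class-at inward (full inward) i not-loop
  ... | e , e≡ , ce | e' , e'≡ , ce' = subst (λ i → S _ (colour i b)) ce (both-colours outward e≡ e'≡ (trans ce (sym ce')) b)

  no-loops : ∀ {v} → loops (profile v) ≡ 0 → ∀ i j → IsLoop v j → arcClass (inj₂ (v , j)) ≢ i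
  no-loops {v} loops≡ i j loop = ⊥-elim (n≮0 (subst (toℕ j <_) loops≡ loop))

  degree-1-interval : ∀ {v} → degree G v ≡ 1 → CyclicInterval (S v)
  degree-1-interval {v} d≡1 with length≡1 {xs = edgesAt v} d≡1
  ... | e , e∈ , only = single-colour (colouring e) λ c →
    mk⇔ (λ { (e' , inc , refl) → cong colouring (only (∈-edgesAt inc)) }) (λ c≡ → e , edgesAt-incident e∈ , sym c≡)

  degree-2-interval : ∀ {v} → (∀ d → length (edges d v) ≡ 1) → loops (profile v) ≡ suc k → CyclicInterval (S v)
  degree-2-interval {v} len loops≡ with length≡1 (len inward) | length≡1 (len outward)
  ... | e , e∈ , only-in | f , _ , only-out = one-pair (class e) (doubled full (class e) not-loop) only
    where
      full : ∀ d → length (edges d v) + loops (profile v) ≡ r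
      full d = cong₂ _+_ (len d) loops≡
      not-loop : ∀ j → IsLoop v j → arcClass (inj₂ (v , j)) ≢ class e
      not-loop j loop = class≢loop loop (subst (Incident G e) (incoming-head e∈) (head-incident e)) ∘ sym
      edge-class : ∀ {e'} → Incident G e' v → class e' ≡ class e
      edge-class inc with incident⇒endpoint inc | class-at outward (full outward) (class e) not-loop
      ... | outward , e'≡ | f' , f'≡ , cf' = trans (cong class (trans (only-out (∈-outgoing e'≡)) (sym (only-out (∈-outgoing f'≡))))) cf'
      ... | inward , e'≡ | _ = cong class (only-in (∈-incoming e'≡))
      only : ∀ {c} → S v c → ∃ λ b → colour (class e) b ≡ c
      only (e' , inc , refl) = bit e' , cong₂ colour (sym (edge-class inc)) refl

  degree-2r-2-interval : ∀ {v} → (∀ d → length (edges d v) ≡ suc k) → loops (profile v) ≡ 1 → CyclicInterval (S v)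
  degree-2r-2-interval {v} len loops≡ = all-but-pair γ present absent
    where
      loop₀ : IsLoop v 0F
      loop₀ = subst (0 <_) (sym loops≡) (s≤s z≤n)
      γ : Fin r
      γ = arcClass (inj₂ (v , 0F))
      full : ∀ d → length (edges d v) + loops (profile v) ≡ r
      full d = trans (cong₂ _+_ (len d) loops≡) (+-comm (suc k) 1)
      only-loop : ∀ {j} → IsLoop v j → j ≡ 0F
      only-loop loop = toℕ-injective (n<1⇒n≡0 (subst (_ <_) loops≡ loop))
      present : ∀ j → j ≢ γ → ∀ b → S v (colour j b)
      present j j≢γ = doubled full j λ j' loop eq → j≢γ (trans (sym eq) (cong (λ x → arcClass (inj₂ (v , x))) (only-loop loop)))
      absent : ∀ b → ¬ S v (colour γ b)
      absent b (e , inc , eq) = class≢loop loop₀ inc (proj₁ (colour-injective eq))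

  module Degree-2r-1 {v} d (len : length (edges d v) ≡ r) (len′ : length (edges (opposite d) v) ≡ suc k)
    (loops≡ : loops (profile v) ≡ 0) where

    at-d : ∀ i → ∃ λ e → endpoint d e ≡ v × class e ≡ i
    at-d i = class-at d (trans (cong₂ _+_ len loops≡) (+-identityʳ r)) i (no-loops loops≡ i)

    abstract
      missing-class : Σ (Fin r) λ j → (∀ {e} → e ∈ edges (opposite d) v → class e ≢ j) ×
        (∀ i → i ≢ j → ∃ λ e → e ∈ edges (opposite d) v × class e ≡ i)
      missing-class = image-misses-one class (edges-unique (opposite d) v) (edges-classes (opposite d) v) (cong suc len′)

    j : Fin r
    j = proj₁ missing-class

    eⱼ : E
    eⱼ = proj₁ (at-d j)

    eⱼ-incident : Incident G eⱼ v
    eⱼ-incident = subst (Incident G eⱼ) (proj₁ (proj₂ (at-d j))) (endpoint-incident d eⱼ)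

    b₀ : Fin 2
    b₀ = bit eⱼ

    other-class : ∀ i → i ≢ j → ∀ b → S v (colour i b)
    other-class i i≢j b with at-d i | proj₂ (proj₂ missing-class) i i≢j
    ... | e , e≡ , ce | e' , e'∈ , ce' =
      subst (λ i → S v (colour i b)) ce (both-colours d e≡ (edges-endpoint (opposite d) e'∈) (trans ce (sym ce')) b)

    present : ∀ i b → colour i b ≢ colour j (flip b₀) → S v (colour i b)
    present i b ne with i ≟ᶠ j | Fin2-cases (flip-≢ b₀ ∘ sym) b
    ... | no i≢j | _ = other-class i i≢j b
    ... | yes i≡j | inj₁ b≡b₀ = eⱼ , eⱼ-incident , cong₂ colour (trans (proj₂ (proj₂ (at-d j))) (sym i≡j)) (sym b≡b₀)
    ... | yes i≡j | inj₂ b≡flip = contradiction (cong₂ colour i≡j b≡flip) ne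

    absent : ¬ S v (colour j (flip b₀))
    absent (e , inc , eq) with colour-injective eq | incident⇒endpoint inc
    ... | ce , be | d' , e≡ with direction-cases d d'
    ...   | inj₂ refl = proj₁ (proj₂ missing-class) (∈-edges (opposite d) e≡) ce
    ...   | inj₁ refl = flip-≢ b₀ (trans (sym be) (cong bit e≡eⱼ))
      where
        e≡eⱼ : e ≡ eⱼ
        e≡eⱼ = decidable-stable (e ≟ᶠ eⱼ) λ e≢eⱼ →
          class-proper d e≢eⱼ (trans e≡ (sym (proj₁ (proj₂ (at-d j))))) (trans ce (sym (proj₂ (proj₂ (at-d j)))))

    interval : CyclicInterval (S v)
    interval = all-but-one j (flip b₀) present absent

  degree-2r-interval : ∀ {v} → (∀ d → length (edges d v) ≡ r) → loops (profile v) ≡ 0 → CyclicInterval (S v)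
  degree-2r-interval len loops≡ = all-colours
    (λ i → doubled (λ d → trans (cong₂ _+_ (len d) loops≡) (+-identityʳ r)) i (no-loops loops≡ i))
    (λ { (e , _ , refl) → colour-range (class e) (bit e) })

  cyclic-at : ∀ v → CyclicInterval (S v)
  cyclic-at v with profile v in eq
  ... | degree-1 d≡1 = degree-1-interval d≡1
  ... | degree-2 len = degree-2-interval len (cong loops eq)
  ... | degree-2r-2 len = degree-2r-2-interval len (cong loops eq)
  ... | degree-2r-1 d len len′ = Degree-2r-1.interval d len len′ (cong loops eq)
  ... | degree-2r len = degree-2r-interval len (cong loops eq)

  cyclic-interval-colouring : CyclicIntervalColoring G (2 * r) colouring
  cyclic-interval-colouring = colouring-range , colouring-proper , cyclic-at

theorem1 : (r : ℕ) → 2 ≤ r → (G : Multigraph) → Bipartite G → MaxDegree G (2 * r) →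
    ((v : Fin (n G)) → (degree G v ≡ 1) ⊎ (degree G v ≡ 2) ⊎ (degree G v ≡ 2 * r ∸ 2)
      ⊎ (degree G v ≡ 2 * r ∸ 1) ⊎ (degree G v ≡ 2 * r)) →
    Σ (Fin (m G) → ℕ) (λ α → CyclicIntervalColoring G (2 * r) α)
theorem1 (suc (suc k)) (s≤s (s≤s z≤n)) G (side , bipartite) _ admissible = colouring , cyclic-interval-colouring
  where open Construction k G side bipartite admissible
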